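{- Any binary mergesort has (worst-case) fragile complexity $\Omega(\log^2 n)$: there is an absolute constant $c>0$ such that for every $n$ and every binary mergesort algorithm, there is an input of $n$ elements on which some element participates in at least $c\log^2 n$ comparisons.
   Context: A binary mergesort is a deterministic comparison-based sorting algorithm that, on an input set of more than one element, splits it into two nonempty parts (of arbitrary sizes), sorts each part recursively (with no comparisons between elements of different parts), and then merges the two resulting sorted sequences using an arbitrary comparison-based merging procedure. Fragile complexity is the maximum number of comparisons any single element participates in. -}

module Defs where

open import Data.Nat using (ℕ; zero; suc; _+_; _<_; _<ᵇ_)
open import Data.Fin using (Fin; _≟_) renaming (_<_ to _<ᶠ_)
open import Data.Sum using (_⊎_; inj₁; inj₂; [_,_])
open import Data.List using (List; []; _∷_; _++_; map)
open import Data.Product using (_×_; _,_; proj₁; proj₂)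
open import Data.Bool using (true; false; _∨_)
open import Function using (_∘_)
open import Function.Bundles using (_↔_; Inverse)
open import Relation.Nullary.Decidable using (⌊_⌋)
open import Relation.Binary.PropositionalEquality using (_≢_)

-- A comparison-based decision tree over items of type I with outputs in O.
-- `cmp p q lt ge` compares the values of items p and q: goes to `lt` if
-- value(p) < value(q), otherwise to `ge`.
data DTree (I O : Set) : Set where
  leaf : O → DTree I O
  cmp  : I → I → DTree I O → DTree I O → DTree I O

private
  addCmp : ∀ {I O : Set} → I × I → O × List (I × I) → O × List (I × I)
  addCmp c (o , cs) = o , c ∷ cs

run : ∀ {I O : Set} → (I → ℕ) → DTree I O → O × List (I × I)
run v (leaf o) = o , []
run v (cmp p q lt ge) with v p <ᵇ v q
... | true  = addCmp (p , q) (run v lt)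
... | false = addCmp (p , q) (run v ge)

Increasing : ∀ {m} → (Fin m → ℕ) → Set
Increasing {m} f = ∀ (i j : Fin m) → i <ᶠ j → f i < f j

-- Items: inj₁ i = i-th smallest of the first sequence, inj₂ j = j-th
-- smallest of the second.  Output: for each rank r of the merged sequence,
-- the item that has rank r.
Merge : ℕ → ℕ → Set
Merge a b = DTree (Fin a ⊎ Fin b) (Fin (a + b) → Fin a ⊎ Fin b)

-- Correctness of a merging procedure: on all sorted inputs with distinct
-- values, the produced output lists the items in strictly increasing order
-- (hence it is a bijection onto all a + b items, i.e. the correct merge).
MergeCorrect : ∀ {a b} → Merge a b → Set
MergeCorrect {a} {b} M =
  ∀ (u : Fin a → ℕ) (w : Fin b → ℕ) → Increasing u → Increasing w →
  (∀ i j → u i ≢ w j) → Increasing ([ u , w ] ∘ proj₁ (run [ u , w ] M))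

data Mergesort : ℕ → Set where
  single : Mergesort 1
  split  : ∀ {a b} →
           (Fin (suc a + suc b) ↔ (Fin (suc a) ⊎ Fin (suc b))) →
           Mergesort (suc a) → Mergesort (suc b) →
           (M : Merge (suc a) (suc b)) → MergeCorrect M →
           Mergesort (suc a + suc b)

-- Execute a mergesort on input values x : Fin n → ℕ.  Returns the output
-- order (rank ↦ position) and the list of all comparisons performed
-- (as pairs of positions).
execute : ∀ {n} → Mergesort n → (Fin n → ℕ) →
          (Fin n → Fin n) × List (Fin n × Fin n)
execute single x = (λ r → r) , []
execute (split {a} {b} σ L R M _) x =
  (pos ∘ proj₁ resM) ,
  (map (λ c → pos (proj₁ c) , pos (proj₂ c)) (proj₂ resM)
    ++ map (λ c → fromL (proj₁ c) , fromL (proj₂ c)) (proj₂ resL)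
    ++ map (λ c → fromR (proj₁ c) , fromR (proj₂ c)) (proj₂ resR))
  where
  fromL : Fin (suc a) → Fin (suc a + suc b)
  fromL i = Inverse.from σ (inj₁ i)
  fromR : Fin (suc b) → Fin (suc a + suc b)
  fromR j = Inverse.from σ (inj₂ j)
  resL = execute L (x ∘ fromL)
  resR = execute R (x ∘ fromR)
  pos : Fin (suc a) ⊎ Fin (suc b) → Fin (suc a + suc b)
  pos (inj₁ i) = fromL (proj₁ resL i)
  pos (inj₂ j) = fromR (proj₁ resR j)
  resM = run (x ∘ pos) M

participations : ∀ {n} → Fin n → List (Fin n × Fin n) → ℕ
participations p [] = zero
participations p ((q , r) ∷ cs) with ⌊ q ≟ p ⌋ ∨ ⌊ r ≟ p ⌋
... | true  = suc (participations p cs)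
... | false = participations p cs

fragility : ∀ {n} → Mergesort n → (Fin n → ℕ) → Fin n → ℕ
fragility A x p = participations p (proj₂ (execute A x))

-- The adversary follows the heavy path of the recursion. At a split it reuses the hard input
-- and the hard element p of the larger part and keeps every relative order inside both parts,
-- but lets the value of p slide through the t + 1 gaps between the t elements of the smaller
-- part. These t + 1 inputs differ only in comparisons involving p, while a correct merge must
-- produce t + 1 different interleavings; since each comparison splits the inputs in two, p is
-- compared at least ⌊log₂ (t + 1)⌋ times on one of them.
-- Summing ⌊log₂ (1 + light size)⌋ along the heavy path gives at least ⌊log₂ n⌋² / 4: cut the
-- path where the remaining part first has at most n/2 elements; the removed r ≥ n/2 elements
-- contribute at least ⌊log₂ n⌋ − 1 because r ↦ ⌊log₂ (1 + r)⌋ is subadditive, and the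
-- remaining part, whose logarithm is at least ⌊log₂ n⌋ − 2, is handled by induction.

module Submission where

open import Defs
open import Data.Bool using (Bool; true; false; _∨_; if_then_else_)
import Data.Bool as Bool
open import Data.Fin as Fin using (Fin; toℕ; fromℕ<) renaming (_<_ to _<ᶠ_)
import Data.Fin.Properties as Fin
open import Data.List using (List; []; _∷_; _++_; map; length; filter; allFin)
open import Data.List.Membership.Propositional using (_∈_)
open import Data.List.Membership.Propositional.Properties using (∈-filter⁻)
open import Data.List.Properties using (map-cong; length-tabulate)
open import Data.List.Relation.Unary.Any using (here; there)
open import Data.List.Relation.Unary.All using ([]; _∷_)
open import Data.List.Relation.Unary.AllPairs using ([]; _∷_)
open import Data.List.Relation.Unary.Unique.Propositional using (Unique)
open import Data.List.Relation.Unary.Unique.Propositional.Properties using (allFin⁺)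
import Data.List.Relation.Unary.Unique.Propositional.Properties as Unique
open import Data.Nat
open import Data.Nat.Induction using (<-rec)
open import Data.Nat.Logarithm
open import Data.Nat.Properties
open import Data.Nat.Tactic.RingSolver using (solve-∀)
open import Algebra.Properties.CommutativeSemigroup +-commutativeSemigroup using (xy∙z≈xz∙y)
open import Data.Product using (∃; _×_; _,_; proj₁; proj₂)
open import Data.Sum as Sum using (_⊎_; inj₁; inj₂; [_,_]; swap)
import Data.Sum.Properties as Sum
open import Function using (_∘_)
open import Function.Bundles using (_↔_; Inverse)
open import Function.Definitions using (Injective)
open import Relation.Binary.Definitions using (DecidableEquality; tri<; tri≈; tri>)
open import Relation.Binary.PropositionalEquality hiding ([_])
open import Relation.Nullary using (¬_; Dec; yes; no; does; contradiction)
open import Relation.Nullary.Decidable using (⌊_⌋; _⊎-dec_)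
import Relation.Nullary.Reflects as Reflects

-- run branches on _<ᵇ_, so inputs in the same relative order follow the same path.
SameOrder : {I : Set} → (I → ℕ) → (I → ℕ) → Set
SameOrder v w = ∀ i j → (v i <ᵇ v j) ≡ (w i <ᵇ w j)

sameOrder-sym : {I : Set} {v w : I → ℕ} → SameOrder v w → SameOrder w v
sameOrder-sym same i j = sym (same i j)

sameOrder-trans : {I : Set} {u v w : I → ℕ} → SameOrder u v → SameOrder v w → SameOrder u w
sameOrder-trans same same′ i j = trans (same i j) (same′ i j)

≗⇒sameOrder : {I : Set} {v w : I → ℕ} → v ≗ w → SameOrder v w
≗⇒sameOrder v≗w i j = cong₂ _<ᵇ_ (v≗w i) (v≗w j)

<ᵇ-cong : ∀ {m n m′ n′} → (m < n → m′ < n′) → (m′ < n′ → m < n) →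
          (m <ᵇ n) ≡ (m′ <ᵇ n′)
<ᵇ-cong {m} {n} {m′} {n′} to from =
  Reflects.det (<ᵇ-reflects-< m n) (Reflects.fromEquivalence (from ∘ <ᵇ⇒< m′ n′) (<⇒<ᵇ ∘ to))

strictlyMonotone⇒sameOrder : {I : Set} {v w : I → ℕ} → Injective _≡_ _≡_ w →
                             (∀ i j → w i < w j → v i < v j) → SameOrder v w
strictlyMonotone⇒sameOrder {v = v} {w} w-inj mono i j = <ᵇ-cong reflect (mono i j)
  where
  reflect : v i < v j → w i < w j
  reflect vi<vj with <-cmp (w i) (w j)
  ... | tri< wi<wj _ _ = wi<wj
  ... | tri≈ _ wi≡wj _ =
    contradiction (subst (λ k → v i < v k) (sym (w-inj wi≡wj)) vi<vj) (<-irrefl refl)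
  ... | tri> _ _ wj<wi = contradiction (mono j i wj<wi) (<-asym vi<vj)

consComparison : {I O : Set} → I × I → O × List (I × I) → O × List (I × I)
consComparison c r = proj₁ r , c ∷ proj₂ r

run-cmp : {I O : Set} (v : I → ℕ) (p q : I) (lt ge : DTree I O) →
          run v (cmp p q lt ge) ≡ consComparison (p , q) (run v (if v p <ᵇ v q then lt else ge))
run-cmp v p q lt ge with v p <ᵇ v q
... | true = refl
... | false = refl

run-sameOrder : {I O : Set} {v w : I → ℕ} → SameOrder v w → (T : DTree I O) → run v T ≡ run w T
run-sameOrder same (leaf o) = refl
run-sameOrder {v = v} {w} same (cmp p q lt ge) with v p <ᵇ v q | w p <ᵇ w q | same p q
... | true  | .true  | refl = cong (consComparison (p , q)) (run-sameOrder same lt)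
... | false | .false | refl = cong (consComparison (p , q)) (run-sameOrder same ge)

mapComparisons : {I J : Set} → (I → J) → List (I × I) → List (J × J)
mapComparisons f = map (λ c → f (proj₁ c) , f (proj₂ c))

mapComparisons-cong : {I J : Set} {f g : I → J} → f ≗ g →
                      ∀ cs → mapComparisons f cs ≡ mapComparisons g cs
mapComparisons-cong f≗g = map-cong (λ c → cong₂ _,_ (f≗g (proj₁ c)) (f≗g (proj₂ c)))

module _ {I : Set} (_≟_ : DecidableEquality I) where

  participationsIn : I → List (I × I) → ℕ
  participationsIn e [] = zero
  participationsIn e ((p , q) ∷ cs) with (p ≟ e) ⊎-dec (q ≟ e)
  ... | yes _ = suc (participationsIn e cs)
  ... | no _  = participationsIn e cs

  participationsIn-++ : ∀ e cs ds →
    participationsIn e (cs ++ ds) ≡ participationsIn e cs + participationsIn e ds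
  participationsIn-++ e [] ds = refl
  participationsIn-++ e ((p , q) ∷ cs) ds with (p ≟ e) ⊎-dec (q ≟ e)
  ... | yes _ = cong suc (participationsIn-++ e cs ds)
  ... | no _  = participationsIn-++ e cs ds

  participationsIn-∷-≤ : ∀ e c cs → participationsIn e cs ≤ participationsIn e (c ∷ cs)
  participationsIn-∷-≤ e (p , q) cs with (p ≟ e) ⊎-dec (q ≟ e)
  ... | yes _ = n≤1+n _
  ... | no _  = ≤-refl

  participationsIn-∷-involved : ∀ {e p q} cs → p ≡ e ⊎ q ≡ e →
    participationsIn e ((p , q) ∷ cs) ≡ suc (participationsIn e cs)
  participationsIn-∷-involved {e} {p} {q} cs involved with (p ≟ e) ⊎-dec (q ≟ e)
  ... | yes _ = refl
  ... | no uninvolved = contradiction involved uninvolved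

participationsIn-map-≤ : {I J : Set} (_≟ᴵ_ : DecidableEquality I) (_≟ᴶ_ : DecidableEquality J)
  (f : I → J) (e : I) (cs : List (I × I)) →
  participationsIn _≟ᴵ_ e cs ≤ participationsIn _≟ᴶ_ (f e) (mapComparisons f cs)
participationsIn-map-≤ _≟ᴵ_ _≟ᴶ_ f e [] = z≤n
participationsIn-map-≤ _≟ᴵ_ _≟ᴶ_ f e ((p , q) ∷ cs) with (p ≟ᴵ e) ⊎-dec (q ≟ᴵ e)
... | yes involved = ≤-trans (s≤s (participationsIn-map-≤ _≟ᴵ_ _≟ᴶ_ f e cs))
  (≤-reflexive (sym (participationsIn-∷-involved _≟ᴶ_ _ (Sum.map (cong f) (cong f) involved))))
... | no _ = ≤-trans (participationsIn-map-≤ _≟ᴵ_ _≟ᴶ_ f e cs)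
                     (participationsIn-∷-≤ _≟ᴶ_ (f e) _ (mapComparisons f cs))

participations≡participationsIn : ∀ {n} (p : Fin n) cs →
                                  participations p cs ≡ participationsIn Fin._≟_ p cs
participations≡participationsIn p [] = refl
participations≡participationsIn p ((q , r) ∷ cs) with q Fin.≟ p | r Fin.≟ p
... | yes _ | _     = cong suc (participations≡participationsIn p cs)
... | no _  | yes _ = cong suc (participations≡participationsIn p cs)
... | no _  | no _  = participations≡participationsIn p cs

-- Trees separating inputs that differ at a single item

⌊log₂⌋-≤-suc : ∀ {n k} → 0 < k → n ≤ 2 * k → ⌊log₂ n ⌋ ≤ suc ⌊log₂ k ⌋
⌊log₂⌋-≤-suc {n} {suc k} _ n≤2k =
  ≤-trans (⌊log₂⌋-mono-≤ n≤2k) (≤-reflexive (⌊log₂[2*b]⌋≡1+⌊log₂b⌋ (suc k)))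

larger-half : ∀ m k → m + k ≤ 2 * m ⊎ m + k ≤ 2 * k
larger-half m k with ≤-total k m
... | inj₁ k≤m = inj₁ (subst (m + k ≤_) (cong (m +_) (sym (+-identityʳ m))) (+-monoʳ-≤ m k≤m))
... | inj₂ m≤k = inj₂ (subst (m + k ≤_) (cong (k +_) (sym (+-identityʳ k))) (+-monoˡ-≤ k m≤k))

module DistinguishingBound {I O Ω : Set} (_≟_ : DecidableEquality I) (e : I) (v : Ω → I → ℕ)
  (stable : ∀ ω ω′ i → i ≢ e → v ω i ≡ v ω′ i) where

  outputOf : DTree I O → Ω → O
  outputOf T ω = proj₁ (run (v ω) T)

  participationsOf : DTree I O → Ω → ℕ
  participationsOf T ω = participationsIn _≟_ e (proj₂ (run (v ω) T))

  Separates : DTree I O → List Ω → Set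
  Separates T ωs =
    ∀ {ω ω′} → ω ∈ ωs → ω′ ∈ ωs → outputOf T ω ≡ outputOf T ω′ → ω ≡ ω′

  outcome : I → I → Ω → Bool
  outcome p q ω = v ω p <ᵇ v ω q

  branch : Bool → DTree I O → DTree I O → DTree I O
  branch b lt ge = if b then lt else ge

  answering : I → I → Bool → List Ω → List Ω
  answering p q b = filter (λ ω → outcome p q ω Bool.≟ b)

  ∈-answering⁻ : ∀ {p q b ω} ωs → ω ∈ answering p q b ωs → ω ∈ ωs × outcome p q ω ≡ b
  ∈-answering⁻ {p} {q} {b} ωs = ∈-filter⁻ (λ ω → outcome p q ω Bool.≟ b) {xs = ωs}

  length-answering : ∀ p q ωs →
    length (answering p q true ωs) + length (answering p q false ωs) ≡ length ωs
  length-answering p q [] = refl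
  length-answering p q (ω ∷ ωs) with outcome p q ω
  ... | true  = cong suc (length-answering p q ωs)
  ... | false = trans (+-suc _ _) (cong suc (length-answering p q ωs))

  output-cmp : ∀ {p q lt ge} ω b → outcome p q ω ≡ b →
    outputOf (cmp p q lt ge) ω ≡ outputOf (branch b lt ge) ω
  output-cmp {p} {q} {lt} {ge} ω b refl = cong proj₁ (run-cmp (v ω) p q lt ge)

  participationsOf-cmp : ∀ {p q lt ge} ω b → outcome p q ω ≡ b →
    participationsOf (cmp p q lt ge) ω
      ≡ participationsIn _≟_ e ((p , q) ∷ proj₂ (run (v ω) (branch b lt ge)))
  participationsOf-cmp {p} {q} {lt} {ge} ω b refl =
    cong (participationsIn _≟_ e ∘ proj₂) (run-cmp (v ω) p q lt ge)

  separates-branch : ∀ {p q lt ge ωs ωs′} b →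
    (∀ {ω} → ω ∈ ωs′ → ω ∈ ωs × outcome p q ω ≡ b) →
    Separates (cmp p q lt ge) ωs → Separates (branch b lt ge) ωs′
  separates-branch {p} {q} {lt} {ge} b sub sep {ω} {ω′} ω∈ ω′∈ same =
    sep (proj₁ (sub ω∈)) (proj₁ (sub ω′∈)) (begin
      outputOf (cmp p q lt ge) ω  ≡⟨ output-cmp ω b (proj₂ (sub ω∈)) ⟩
      outputOf (branch b lt ge) ω  ≡⟨ same ⟩
      outputOf (branch b lt ge) ω′ ≡⟨ output-cmp ω′ b (proj₂ (sub ω′∈)) ⟨
      outputOf (cmp p q lt ge) ω′ ∎)
    where open ≡-Reasoning

  separates-leaf : ∀ {o ωs} → Unique ωs → Separates (leaf o) ωs → length ωs ≤ 1
  separates-leaf [] _ = z≤n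
  separates-leaf (_ ∷ []) _ = ≤-refl
  separates-leaf ((ω≢ω′ ∷ _) ∷ _) sep = contradiction (sep (here refl) (there (here refl)) refl) ω≢ω′

  Bound : DTree I O → Set
  Bound T = ∀ ωs → Unique ωs → Separates T ωs → 0 < length ωs →
            ∃ λ ω → ω ∈ ωs × ⌊log₂ length ωs ⌋ ≤ participationsOf T ω

  bound-involved : ∀ {p q lt ge} → (∀ b → Bound (branch b lt ge)) → p ≡ e ⊎ q ≡ e →
    ∀ b ωs → Unique ωs → Separates (cmp p q lt ge) ωs → 0 < length ωs →
    length ωs ≤ 2 * length (answering p q b ωs) →
    ∃ λ ω → ω ∈ ωs × ⌊log₂ length ωs ⌋ ≤ participationsOf (cmp p q lt ge) ω
  bound-involved {p} {q} ih involved b ωs uniq sep nonempty half =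
    let ω , ω∈ , bound = ih b ωsᵇ (Unique.filter⁺ _ uniq) (separates-branch b (∈-answering⁻ ωs) sep)
                            nonemptyᵇ
    in  ω , proj₁ (∈-answering⁻ ωs ω∈) ,
        ≤-trans (⌊log₂⌋-≤-suc nonemptyᵇ half) (≤-trans (s≤s bound)
          (≤-reflexive (sym (trans (participationsOf-cmp ω b (proj₂ (∈-answering⁻ ωs ω∈)))
                                   (participationsIn-∷-involved _≟_ _ involved)))))
    where
    ωsᵇ : List Ω
    ωsᵇ = answering p q b ωs
    nonemptyᵇ : 0 < length ωsᵇ
    nonemptyᵇ = *-cancelˡ-< 2 0 (length ωsᵇ) (≤-trans nonempty half)

  bound-cmp : ∀ {p q lt ge} → (∀ b → Bound (branch b lt ge)) → Bound (cmp p q lt ge)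
  bound-cmp {p} {q} {lt} {ge} ih ωs@(ω₀ ∷ _) uniq sep nonempty with (p ≟ e) ⊎-dec (q ≟ e)
  ... | no uninvolved =
    let ω , ω∈ , bound = ih b₀ ωs uniq (separates-branch b₀ (λ ω∈ → ω∈ , agrees ω∈) sep) nonempty
    in  ω , ω∈ , ≤-trans bound (≤-trans (participationsIn-∷-≤ _≟_ e (p , q) _)
                                        (≤-reflexive (sym (participationsOf-cmp ω b₀ (agrees ω∈)))))
    where
    b₀ : Bool
    b₀ = outcome p q ω₀
    agrees : ∀ {ω} → ω ∈ ωs → outcome p q ω ≡ b₀
    agrees {ω} _ =
      cong₂ _<ᵇ_ (stable ω ω₀ p (uninvolved ∘ inj₁)) (stable ω ω₀ q (uninvolved ∘ inj₂))
  ... | yes involved with larger-half (length (answering p q true ωs)) (length (answering p q false ωs))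
  ...   | inj₁ half = bound-involved ih involved true  ωs uniq sep nonempty
                        (subst (_≤ 2 * length (answering p q true ωs)) (length-answering p q ωs) half)
  ...   | inj₂ half = bound-involved ih involved false ωs uniq sep nonempty
                        (subst (_≤ 2 * length (answering p q false ωs)) (length-answering p q ωs) half)

  lower-bound : ∀ T → Bound T
  lower-bound (leaf o) (ω ∷ ωs) uniq sep _ =
    ω , here refl , ≤-trans (⌊log₂⌋-mono-≤ (separates-leaf uniq sep)) z≤n
  lower-bound (cmp p q lt ge) = bound-cmp λ { true → lower-bound lt ; false → lower-bound ge }

Fin-injective⇒surjective : ∀ {n} {f : Fin n → Fin n} → Injective _≡_ _≡_ f →
                           ∀ y → ∃ λ x → f x ≡ y
Fin-injective⇒surjective {suc n} {f} f-inj y with Fin.any? (λ x → f x Fin.≟ y)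
... | yes hit = hit
... | no miss = contradiction (Fin.injective⇒≤ punchOut-f-injective) (n≮n n)
  where
  y≢f : ∀ x → y ≢ f x
  y≢f x y≡fx = miss (x , sym y≡fx)
  punchOut-f-injective : Injective _≡_ _≡_ (λ x → Fin.punchOut (y≢f x))
  punchOut-f-injective {x} {x′} eq = f-inj (Fin.punchOut-injective (y≢f x) (y≢f x′) eq)

Fin⊎-injective⇒surjective : ∀ {m n} {f : Fin (m + n) → Fin m ⊎ Fin n} → Injective _≡_ _≡_ f →
                            ∀ y → ∃ λ x → f x ≡ y
Fin⊎-injective⇒surjective {m} {n} {f} f-inj y =
  let x , join-fx≡join-y = Fin-injective⇒surjective (f-inj ∘ join-injective) (Fin.join m n y)
  in  x , join-injective join-fx≡join-y
  where
  join-injective : Injective _≡_ _≡_ (Fin.join m n)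
  join-injective {i} {j} eq = trans (sym (Fin.splitAt-join m n i))
                                    (trans (cong (Fin.splitAt m) eq) (Fin.splitAt-join m n j))

increasing⇒injective : ∀ {m} {I : Set} (v : I → ℕ) {o : Fin m → I} →
                       Increasing (v ∘ o) → Injective _≡_ _≡_ o
increasing⇒injective v inc {k} {k′} eq with Fin.<-cmp k k′
... | tri< k<k′ _ _ = contradiction (inc k k′ k<k′) (<-irrefl (cong v eq))
... | tri≈ _ k≡k′ _ = k≡k′
... | tri> _ _ k′<k = contradiction (inc k′ k k′<k) (<-irrefl (cong v (sym eq)))

sorted-orders-agree : ∀ {m} {I : Set} {o : Fin m → I} (v w : I → ℕ) → (∀ i → ∃ λ k → o k ≡ i) →
  Increasing (v ∘ o) → Increasing (w ∘ o) → ∀ i j → v i < v j → ¬ w j < w i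
sorted-orders-agree {o = o} v w onto v-inc w-inc i j vi<vj wj<wi
  with onto i | onto j
... | k , refl | k′ , refl with Fin.<-cmp k k′
...   | tri< k<k′ _ _ = <-asym wj<wi (w-inc k k′ k<k′)
...   | tri≈ _ refl _ = <-irrefl refl vi<vj
...   | tri> _ _ k′<k = <-asym vi<vj (v-inc k′ k k′<k)

sorted-permutations-differ : ∀ {m n} {o o′ : Fin (m + n) → Fin m ⊎ Fin n}
                             (v v′ : Fin m ⊎ Fin n → ℕ) →
  Increasing (v ∘ o) → Increasing (v′ ∘ o′) → ∀ i j → v i < v j → v′ j < v′ i → o ≢ o′
sorted-permutations-differ v v′ inc inc′ i j vi<vj v′j<v′i refl =
  sorted-orders-agree v v′ (Fin⊎-injective⇒surjective (increasing⇒injective v inc)) inc inc′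
    i j vi<vj v′j<v′i

increasing-≗ : ∀ {m} {f g : Fin m → ℕ} → f ≗ g → Increasing f → Increasing g
increasing-≗ f≗g inc i j i<j = subst₂ _<_ (f≗g i) (f≗g j) (inc i j i<j)

correct-merge-sorts : ∀ {a b} {M : Merge a b} → MergeCorrect M → (v : Fin a ⊎ Fin b → ℕ) →
  (∀ i j → v (inj₁ i) ≢ v (inj₂ j)) → Increasing (v ∘ inj₁) → Increasing (v ∘ inj₂) →
  Increasing (v ∘ proj₁ (run v M))
correct-merge-sorts {M = M} correct v disjoint inc₁ inc₂ =
  subst (λ r → Increasing (v ∘ proj₁ r)) (run-sameOrder (≗⇒sameOrder split≗v) M)
    (increasing-≗ (split≗v ∘ proj₁ (run [ v ∘ inj₁ , v ∘ inj₂ ] M) )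
      (correct (v ∘ inj₁) (v ∘ inj₂) inc₁ inc₂ disjoint))
  where
  split≗v : [ v ∘ inj₁ , v ∘ inj₂ ] ≗ v
  split≗v (inj₁ i) = refl
  split≗v (inj₂ j) = refl

order : ∀ {n} → Mergesort n → (Fin n → ℕ) → Fin n → Fin n
order A x = proj₁ (execute A x)

comparisons : ∀ {n} → Mergesort n → (Fin n → ℕ) → List (Fin n × Fin n)
comparisons A x = proj₂ (execute A x)

module Split {a b : ℕ} (σ : Fin (suc a + suc b) ↔ (Fin (suc a) ⊎ Fin (suc b)))
             (L : Mergesort (suc a)) (R : Mergesort (suc b))
             (M : Merge (suc a) (suc b)) (correct : MergeCorrect M) where

  Item : Set
  Item = Fin (suc a) ⊎ Fin (suc b)

  fromL : Fin (suc a) → Fin (suc a + suc b)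
  fromL = Inverse.from σ ∘ inj₁

  fromR : Fin (suc b) → Fin (suc a + suc b)
  fromR = Inverse.from σ ∘ inj₂

  from-injective : Injective _≡_ _≡_ (Inverse.from σ)
  from-injective {i} {j} eq = trans (sym (Inverse.strictlyInverseˡ σ i))
                                    (trans (cong (Inverse.to σ) eq) (Inverse.strictlyInverseˡ σ j))

  to-injective : Injective _≡_ _≡_ (Inverse.to σ)
  to-injective {i} {j} eq = trans (sym (Inverse.strictlyInverseʳ σ i))
                                  (trans (cong (Inverse.from σ) eq) (Inverse.strictlyInverseʳ σ j))

  position : (Fin (suc a + suc b) → ℕ) → Item → Fin (suc a + suc b)
  position x = Inverse.from σ ∘ Sum.map (order L (x ∘ fromL)) (order R (x ∘ fromR))

  -- execute places the merged items by a local function; View exposes it as P.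
  record View (x : Fin (suc a + suc b) → ℕ) : Set where
    field
      P            : Item → Fin (suc a + suc b)
      P≗position   : P ≗ position x
      order≡       : order (split σ L R M correct) x ≡ P ∘ proj₁ (run (x ∘ P) M)
      comparisons≡ : comparisons (split σ L R M correct) x ≡
                       mapComparisons P (proj₂ (run (x ∘ P) M))
                         ++ mapComparisons fromL (comparisons L (x ∘ fromL))
                         ++ mapComparisons fromR (comparisons R (x ∘ fromR))

  view : ∀ x → View x
  view x = record
    { P≗position = λ { (inj₁ i) → refl ; (inj₂ j) → refl } ; order≡ = refl ; comparisons≡ = refl }

SameExecution : ∀ {n} → Mergesort n → (Fin n → ℕ) → (Fin n → ℕ) → Set
SameExecution A x y = order A x ≗ order A y × comparisons A x ≡ comparisons A y

execute-sameOrder : ∀ {n} (A : Mergesort n) {x y : Fin n → ℕ} → SameOrder x y → SameExecution A x y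
execute-sameOrder single same = (λ _ → refl) , refl
execute-sameOrder (split σ L R M correct) {x} {y} same =
  (λ k → begin
     order (split σ L R M correct) x k ≡⟨ cong-app X.order≡ k ⟩
     X.P (proj₁ (run (x ∘ X.P) M) k)   ≡⟨ Pˣ≗Pʸ (proj₁ (run (x ∘ X.P) M) k) ⟩
     Y.P (proj₁ (run (x ∘ X.P) M) k)   ≡⟨ cong (λ r → Y.P (proj₁ r k)) same-merge ⟩
     Y.P (proj₁ (run (y ∘ Y.P) M) k)   ≡⟨ cong-app Y.order≡ k ⟨
     order (split σ L R M correct) y k ∎) ,
  (begin
     comparisons (split σ L R M correct) x   ≡⟨ X.comparisons≡ ⟩
     mapComparisons X.P (proj₂ (run (x ∘ X.P) M)) ++ _
       ≡⟨ cong₂ _++_ (trans (mapComparisons-cong Pˣ≗Pʸ _) (cong (mapComparisons Y.P ∘ proj₂) same-merge))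
                     (cong₂ _++_ (cong (mapComparisons fromL) (proj₂ sameL))
                                 (cong (mapComparisons fromR) (proj₂ sameR))) ⟩
     mapComparisons Y.P (proj₂ (run (y ∘ Y.P) M)) ++ _ ≡⟨ Y.comparisons≡ ⟨
     comparisons (split σ L R M correct) y   ∎)
  where
  open Split σ L R M correct
  open ≡-Reasoning
  module X = View (view x)
  module Y = View (view y)
  sameL : SameExecution L (x ∘ fromL) (y ∘ fromL)
  sameL = execute-sameOrder L (λ i j → same (fromL i) (fromL j))
  sameR : SameExecution R (x ∘ fromR) (y ∘ fromR)
  sameR = execute-sameOrder R (λ i j → same (fromR i) (fromR j))
  Pˣ≗Pʸ : X.P ≗ Y.P
  Pˣ≗Pʸ (inj₁ i) =
    trans (X.P≗position (inj₁ i)) (trans (cong fromL (proj₁ sameL i)) (sym (Y.P≗position (inj₁ i))))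
  Pˣ≗Pʸ (inj₂ j) =
    trans (X.P≗position (inj₂ j)) (trans (cong fromR (proj₁ sameR j)) (sym (Y.P≗position (inj₂ j))))
  same-merge : run (x ∘ X.P) M ≡ run (y ∘ Y.P) M
  same-merge = run-sameOrder
    (λ i j → trans (cong₂ (λ k l → x k <ᵇ x l) (Pˣ≗Pʸ i) (Pˣ≗Pʸ j)) (same (Y.P i) (Y.P j))) M

execute-sorts : ∀ {n} (A : Mergesort n) {x : Fin n → ℕ} → Injective _≡_ _≡_ x →
                Increasing (x ∘ order A x)
execute-sorts single _ Fin.zero Fin.zero ()
execute-sorts (split σ L R M correct) {x} x-inj =
  subst (λ o → Increasing (x ∘ o)) (sym orderˣ)
    (correct-merge-sorts {M = M} correct (x ∘ P) disjoint
      (increasing-≗ (λ i → cong x (sym (P≗ (inj₁ i))))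
                    (execute-sorts L (Sum.inj₁-injective ∘ from-injective ∘ x-inj)))
      (increasing-≗ (λ j → cong x (sym (P≗ (inj₂ j))))
                    (execute-sorts R (Sum.inj₂-injective ∘ from-injective ∘ x-inj))))
  where
  open Split σ L R M correct
  open View (view x) renaming (P≗position to P≗; order≡ to orderˣ)
  disjoint : ∀ i j → x (P (inj₁ i)) ≢ x (P (inj₂ j))
  disjoint i j eq with from-injective (trans (sym (P≗ (inj₁ i))) (trans (x-inj eq) (P≗ (inj₂ j))))
  ... | ()

order-injective : ∀ {n} (A : Mergesort n) {x} → Injective _≡_ _≡_ x → Injective _≡_ _≡_ (order A x)
order-injective A {x} x-inj = increasing⇒injective x (execute-sorts A x-inj)

order-onto : ∀ {n} (A : Mergesort n) {x} → Injective _≡_ _≡_ x → ∀ k → ∃ λ i → order A x i ≡ k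
order-onto A x-inj = Fin-injective⇒surjective (order-injective A x-inj)

-- One element sliding through the smaller part

record SlidingInputs {A B t : ℕ} (y : Fin (suc t) → Fin A ⊎ Fin B → ℕ) (s : Fin A ⊎ Fin B) : Set where
  field
    injective  : ∀ ω → Injective _≡_ _≡_ (y ω)
    sameOrder₁ : ∀ ω ω′ → SameOrder (y ω ∘ inj₁) (y ω′ ∘ inj₁)
    sameOrder₂ : ∀ ω ω′ → SameOrder (y ω ∘ inj₂) (y ω′ ∘ inj₂)
    stable     : ∀ ω ω′ k → k ≢ s → y ω k ≡ y ω′ k
    overtakes  : ∀ {ω ω′} → ω <ᶠ ω′ → ∃ λ k → y ω s < y ω k × y ω′ k < y ω′ s

slidingInputs-swap : ∀ {A B t} {y : Fin (suc t) → Fin A ⊎ Fin B → ℕ} {s} →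
  SlidingInputs y s → SlidingInputs (λ ω → y ω ∘ swap) (swap s)
slidingInputs-swap {y = y} {s} sliding = record
  { injective  = λ ω eq →
      trans (sym (Sum.swap-involutive _)) (trans (cong swap (injective ω eq)) (Sum.swap-involutive _))
  ; sameOrder₁ = sameOrder₂
  ; sameOrder₂ = sameOrder₁
  ; stable     = λ ω ω′ k k≢ →
      stable ω ω′ (swap k) (λ eq → k≢ (trans (sym (Sum.swap-involutive k)) (cong swap eq)))
  ; overtakes  = λ ω<ω′ → let k , below , above = overtakes ω<ω′ in
      swap k ,
      subst₂ (λ l m → y _ l < y _ m) (sym (Sum.swap-involutive s)) (sym (Sum.swap-involutive k)) below ,
      subst₂ (λ l m → y _ l < y _ m) (sym (Sum.swap-involutive k)) (sym (Sum.swap-involutive s)) above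
  }
  where open SlidingInputs sliding

module SideInput {a b : ℕ} (σ : Fin (suc a + suc b) ↔ (Fin (suc a) ⊎ Fin (suc b)))
                 (L : Mergesort (suc a)) (R : Mergesort (suc b))
                 (M : Merge (suc a) (suc b)) (correct : MergeCorrect M) where

  open Split σ L R M correct public

  _≟ᵢ_ : DecidableEquality Item
  _≟ᵢ_ = Sum.≡-dec Fin._≟_ Fin._≟_

  sortedItem : (Item → ℕ) → Item → Item
  sortedItem y = Sum.map (order L (y ∘ inj₁)) (order R (y ∘ inj₂))

  mergeRun : (Item → ℕ) → (Fin (suc a + suc b) → Item) × List (Item × Item)
  mergeRun y = run (y ∘ sortedItem y) M

  childParticipations : (Item → ℕ) → Item → ℕ
  childParticipations y (inj₁ i) = participations i (comparisons L (y ∘ inj₁))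
  childParticipations y (inj₂ j) = participations j (comparisons R (y ∘ inj₂))

  mergeRun-sorts : ∀ {y} → Injective _≡_ _≡_ y → Increasing (y ∘ sortedItem y ∘ proj₁ (mergeRun y))
  mergeRun-sorts {y} y-inj = correct-merge-sorts {M = M} correct (y ∘ sortedItem y)
    (λ i j eq → contradiction (y-inj eq) λ ())
    (execute-sorts L (Sum.inj₁-injective ∘ y-inj))
    (execute-sorts R (Sum.inj₂-injective ∘ y-inj))

  sortedItem-injective : ∀ {y} → Injective _≡_ _≡_ y → Injective _≡_ _≡_ (sortedItem y)
  sortedItem-injective y-inj {inj₁ i} {inj₁ j} eq =
    cong inj₁ (order-injective L (Sum.inj₁-injective ∘ y-inj) (Sum.inj₁-injective eq))
  sortedItem-injective y-inj {inj₂ i} {inj₂ j} eq =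
    cong inj₂ (order-injective R (Sum.inj₂-injective ∘ y-inj) (Sum.inj₂-injective eq))

  sortedItem-onto : ∀ {y} → Injective _≡_ _≡_ y → ∀ s → ∃ λ e → sortedItem y e ≡ s
  sortedItem-onto y-inj (inj₁ k) =
    let i , i↦k = order-onto L (Sum.inj₁-injective ∘ y-inj) k in inj₁ i , cong inj₁ i↦k
  sortedItem-onto y-inj (inj₂ k) =
    let j , j↦k = order-onto R (Sum.inj₂-injective ∘ y-inj) k in inj₂ j , cong inj₂ j↦k

  module SideRun (y : Item → ℕ) where

    x : Fin (suc a + suc b) → ℕ
    x = y ∘ Inverse.to σ

    x∘from≗y : ∀ k → x (Inverse.from σ k) ≡ y k
    x∘from≗y k = cong y (Inverse.strictlyInverseˡ σ k)

    sameL : SameExecution L (x ∘ fromL) (y ∘ inj₁)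
    sameL = execute-sameOrder L (≗⇒sameOrder (x∘from≗y ∘ inj₁))

    sameR : SameExecution R (x ∘ fromR) (y ∘ inj₂)
    sameR = execute-sameOrder R (≗⇒sameOrder (x∘from≗y ∘ inj₂))

    open View (view x) public using (P; comparisons≡)

    P≗ : P ≗ Inverse.from σ ∘ sortedItem y
    P≗ (inj₁ i) = cong fromL (proj₁ sameL i)
    P≗ (inj₂ j) = cong fromR (proj₁ sameR j)

    merges : List (Item × Item)
    merges = proj₂ (run (x ∘ P) M)

    childComparisons : List (Fin (suc a + suc b) × Fin (suc a + suc b))
    childComparisons = mapComparisons fromL (comparisons L (x ∘ fromL))
                         ++ mapComparisons fromR (comparisons R (x ∘ fromR))

    merge-≤ : ∀ e → participationsIn _≟ᵢ_ e (proj₂ (mergeRun y))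
                      ≤ participationsIn Fin._≟_ (Inverse.from σ (sortedItem y e)) (mapComparisons P merges)
    merge-≤ e = begin
      participationsIn _≟ᵢ_ e (proj₂ (mergeRun y))
        ≡⟨ cong (participationsIn _≟ᵢ_ e ∘ proj₂) same-merge ⟨
      participationsIn _≟ᵢ_ e merges
        ≤⟨ participationsIn-map-≤ _≟ᵢ_ Fin._≟_ P e merges ⟩
      participationsIn Fin._≟_ (P e) (mapComparisons P merges)
        ≡⟨ cong (λ p → participationsIn Fin._≟_ p (mapComparisons P merges)) (P≗ e) ⟩
      participationsIn Fin._≟_ (Inverse.from σ (sortedItem y e)) (mapComparisons P merges) ∎
      where
      open ≤-Reasoning
      same-merge : run (x ∘ P) M ≡ mergeRun y
      same-merge = run-sameOrder (≗⇒sameOrder λ k → trans (cong x (P≗ k)) (x∘from≗y (sortedItem y k))) M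

    child-≤ : ∀ e → childParticipations y (sortedItem y e)
                      ≤ participationsIn Fin._≟_ (Inverse.from σ (sortedItem y e)) childComparisons
    child-≤ (inj₁ i) = begin
      participations k (comparisons L (y ∘ inj₁))   ≡⟨ cong (participations k) (proj₂ sameL) ⟨
      participations k csᴸ                          ≡⟨ participations≡participationsIn k csᴸ ⟩
      participationsIn Fin._≟_ k csᴸ                ≤⟨ participationsIn-map-≤ Fin._≟_ Fin._≟_ fromL k csᴸ ⟩
      participationsIn Fin._≟_ (fromL k) mᴸ         ≤⟨ m≤m+n _ _ ⟩
      participationsIn Fin._≟_ (fromL k) mᴸ + participationsIn Fin._≟_ (fromL k) mᴿ
        ≡⟨ participationsIn-++ Fin._≟_ (fromL k) mᴸ mᴿ ⟨
      participationsIn Fin._≟_ (fromL k) childComparisons ∎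
      where
      open ≤-Reasoning
      k : Fin (suc a)
      k = order L (y ∘ inj₁) i
      csᴸ : List (Fin (suc a) × Fin (suc a))
      csᴸ = comparisons L (x ∘ fromL)
      mᴸ mᴿ : List (Fin (suc a + suc b) × Fin (suc a + suc b))
      mᴸ = mapComparisons fromL csᴸ
      mᴿ = mapComparisons fromR (comparisons R (x ∘ fromR))
    child-≤ (inj₂ j) = begin
      participations k (comparisons R (y ∘ inj₂))   ≡⟨ cong (participations k) (proj₂ sameR) ⟨
      participations k csᴿ                          ≡⟨ participations≡participationsIn k csᴿ ⟩
      participationsIn Fin._≟_ k csᴿ                ≤⟨ participationsIn-map-≤ Fin._≟_ Fin._≟_ fromR k csᴿ ⟩
      participationsIn Fin._≟_ (fromR k) mᴿ         ≤⟨ m≤n+m _ _ ⟩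
      participationsIn Fin._≟_ (fromR k) mᴸ + participationsIn Fin._≟_ (fromR k) mᴿ
        ≡⟨ participationsIn-++ Fin._≟_ (fromR k) mᴸ mᴿ ⟨
      participationsIn Fin._≟_ (fromR k) childComparisons ∎
      where
      open ≤-Reasoning
      k : Fin (suc b)
      k = order R (y ∘ inj₂) j
      csᴿ : List (Fin (suc b) × Fin (suc b))
      csᴿ = comparisons R (x ∘ fromR)
      mᴸ mᴿ : List (Fin (suc a + suc b) × Fin (suc a + suc b))
      mᴸ = mapComparisons fromL (comparisons L (x ∘ fromL))
      mᴿ = mapComparisons fromR csᴿ

  split-participations : ∀ y e →
    participationsIn _≟ᵢ_ e (proj₂ (mergeRun y)) + childParticipations y (sortedItem y e)
      ≤ fragility (split σ L R M correct) (y ∘ Inverse.to σ) (Inverse.from σ (sortedItem y e))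
  split-participations y e = begin
    participationsIn _≟ᵢ_ e (proj₂ (mergeRun y)) + childParticipations y (sortedItem y e)
      ≤⟨ +-mono-≤ (merge-≤ e) (child-≤ e) ⟩
    participationsIn Fin._≟_ p (mapComparisons P merges) + participationsIn Fin._≟_ p childComparisons
      ≡⟨ participationsIn-++ Fin._≟_ p (mapComparisons P merges) childComparisons ⟨
    participationsIn Fin._≟_ p (mapComparisons P merges ++ childComparisons)
      ≡⟨ cong (participationsIn Fin._≟_ p) comparisons≡ ⟨
    participationsIn Fin._≟_ p (comparisons (split σ L R M correct) x)
      ≡⟨ participations≡participationsIn p (comparisons (split σ L R M correct) x) ⟨
    fragility (split σ L R M correct) x p ∎
    where
    open ≤-Reasoning
    open SideRun y
    p : Fin (suc a + suc b)
    p = Inverse.from σ (sortedItem y e)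

  module SlidingMerge {t} {y : Fin (suc t) → Item → ℕ} {s : Item} (sliding : SlidingInputs y s) where

    open SlidingInputs sliding

    sorted₀ : Item → Item
    sorted₀ = sortedItem (y Fin.zero)

    sorted≗ : ∀ ω → sortedItem (y ω) ≗ sorted₀
    sorted≗ ω (inj₁ i) = cong inj₁ (proj₁ (execute-sameOrder L (sameOrder₁ ω Fin.zero)) i)
    sorted≗ ω (inj₂ j) = cong inj₂ (proj₁ (execute-sameOrder R (sameOrder₂ ω Fin.zero)) j)

    e : Item
    e = proj₁ (sortedItem-onto (injective Fin.zero) s)

    e↦s : sorted₀ e ≡ s
    e↦s = proj₂ (sortedItem-onto (injective Fin.zero) s)

    v : Fin (suc t) → Item → ℕ
    v ω = y ω ∘ sorted₀

    mergeRun≡ : ∀ ω → mergeRun (y ω) ≡ run (v ω) M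
    mergeRun≡ ω = run-sameOrder (≗⇒sameOrder (cong (y ω) ∘ sorted≗ ω)) M

    v-stable : ∀ ω ω′ i → i ≢ e → v ω i ≡ v ω′ i
    v-stable ω ω′ i i≢e =
      stable ω ω′ (sorted₀ i)
        (λ eq → i≢e (sortedItem-injective (injective Fin.zero) (trans eq (sym e↦s))))

    v-sorts : ∀ ω → Increasing (v ω ∘ proj₁ (run (v ω) M))
    v-sorts ω = subst (λ r → Increasing (v ω ∘ proj₁ r)) (mergeRun≡ ω)
      (increasing-≗ (λ k → cong (y ω) (sorted≗ ω (proj₁ (mergeRun (y ω)) k)))
                    (mergeRun-sorts (injective ω)))

    open DistinguishingBound {O = Fin (suc a + suc b) → Item} _≟ᵢ_ e v v-stable public

    outputs-differ : ∀ {ω ω′} → ω <ᶠ ω′ → outputOf M ω ≢ outputOf M ω′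
    outputs-differ ω<ω′ =
      let k , below , above = overtakes ω<ω′
          j , j↦k = sortedItem-onto (injective Fin.zero) k
      in  sorted-permutations-differ (v _) (v _) (v-sorts _) (v-sorts _) e j
            (subst₂ (λ l m → y _ l < y _ m) (sym e↦s) (sym j↦k) below)
            (subst₂ (λ l m → y _ l < y _ m) (sym j↦k) (sym e↦s) above)

    separates : Separates M (allFin (suc t))
    separates {ω} {ω′} _ _ same with Fin.<-cmp ω ω′
    ... | tri< ω<ω′ _ _ = contradiction same (outputs-differ ω<ω′)
    ... | tri≈ _ ω≡ω′ _ = ω≡ω′
    ... | tri> _ _ ω′<ω = contradiction (sym same) (outputs-differ ω′<ω)

  split-step : ∀ {t} (y : Fin (suc t) → Item → ℕ) (s : Item) → SlidingInputs y s →
    ∃ λ ω → ⌊log₂ suc t ⌋ + childParticipations (y ω) s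
              ≤ fragility (split σ L R M correct) (y ω ∘ Inverse.to σ) (Inverse.from σ s)
  split-step {t} y s sliding =
    let ω , _ , bound = lower-bound M (allFin (suc t)) (allFin⁺ (suc t)) separates (s≤s z≤n)
        merge-bound = subst₂ _≤_ (cong ⌊log₂_⌋ (length-tabulate {n = suc t} (λ ω → ω)))
                                 (cong (participationsIn _≟ᵢ_ e ∘ proj₂) (sym (mergeRun≡ ω))) bound
    in  ω , subst (λ s′ → ⌊log₂ suc t ⌋ + childParticipations (y ω) s′
                            ≤ fragility (split σ L R M correct) (y ω ∘ Inverse.to σ) (Inverse.from σ s′))
                  (trans (sorted≗ ω e) e↦s)
                  (≤-trans (+-monoˡ-≤ _ merge-bound) (split-participations (y ω) e))
    where open SlidingMerge sliding

  split-adversary : ∀ {t} {y : Fin (suc t) → Item → ℕ} {s} {B : ℕ} → SlidingInputs y s →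
    (∀ ω → B ≤ childParticipations (y ω) s) →
    ∃ λ x → Injective _≡_ _≡_ x × ∃ λ p → B + ⌊log₂ suc t ⌋ ≤ fragility (split σ L R M correct) x p
  split-adversary {t} {y} {s} {B} sliding child-bound =
    let ω , bound = split-step y s sliding
    in  y ω ∘ Inverse.to σ , to-injective ∘ injective ω , Inverse.from σ s ,
        ≤-trans (≤-reflexive (+-comm B _)) (≤-trans (+-monoʳ-≤ _ (child-bound ω)) bound)
    where open SlidingInputs sliding

lexicographic-< : ∀ w {hi hi′ lo lo′} → lo < w → hi < hi′ → w * hi + lo < w * hi′ + lo′
lexicographic-< w {hi} {hi′} {lo} {lo′} lo<w hi<hi′ = begin-strict
  w * hi + lo      <⟨ +-monoʳ-< (w * hi) lo<w ⟩
  w * hi + w       ≡⟨ trans (+-comm (w * hi) w) (sym (*-suc w hi)) ⟩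
  w * suc hi       ≤⟨ *-monoʳ-≤ w hi<hi′ ⟩
  w * hi′          ≤⟨ m≤m+n (w * hi′) lo′ ⟩
  w * hi′ + lo′    ∎
  where open ≤-Reasoning

lexicographic-injective : ∀ w {hi hi′ lo lo′} → lo < w → lo′ < w →
  w * hi + lo ≡ w * hi′ + lo′ → hi ≡ hi′ × lo ≡ lo′
lexicographic-injective w {hi} {hi′} {lo} {lo′} lo<w lo′<w eq with <-cmp hi hi′
... | tri< hi<hi′ _ _ = contradiction eq (<⇒≢ (lexicographic-< w lo<w hi<hi′))
... | tri≈ _ refl _ = refl , +-cancelˡ-≡ (w * hi) lo lo′ eq
... | tri> _ _ hi′<hi = contradiction (sym eq) (<⇒≢ (lexicographic-< w lo′<w hi′<hi))

-- Values are width * level + offset with offset < width. The larger part keeps the order of X,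
-- p gets offset 2ω, and the j-th element of the smaller part sits at the level of p with offset
-- 2j + 1, so increasing ω by one moves p past exactly one of them.
module SlidingConstruction {m : ℕ} (X : Fin m → ℕ) (X-injective : Injective _≡_ _≡_ X)
                           (p : Fin m) (t : ℕ) where

  width : ℕ
  width = suc (2 * t)

  shift : Fin (suc t) → Fin m → ℕ
  shift ω i = if does (i Fin.≟ p) then toℕ ω else 0

  level : Fin m ⊎ Fin t → ℕ
  level (inj₁ i) = X i
  level (inj₂ q) = X p

  offset : Fin (suc t) → Fin m ⊎ Fin t → ℕ
  offset ω (inj₁ i) = 2 * shift ω i
  offset ω (inj₂ q) = suc (2 * toℕ q)

  inputs : Fin (suc t) → Fin m ⊎ Fin t → ℕ
  inputs ω k = width * level k + offset ω k

  shift-p : ∀ ω → shift ω p ≡ toℕ ω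
  shift-p ω with p Fin.≟ p
  ... | yes _ = refl
  ... | no p≢p = contradiction refl p≢p

  shift-≢p : ∀ ω {i} → i ≢ p → shift ω i ≡ 0
  shift-≢p ω {i} i≢p with i Fin.≟ p
  ... | yes i≡p = contradiction i≡p i≢p
  ... | no _ = refl

  offset<width : ∀ ω k → offset ω k < width
  offset<width ω (inj₁ i) with does (i Fin.≟ p)
  ... | true  = s≤s (*-monoʳ-≤ 2 (≤-pred (Fin.toℕ<n ω)))
  ... | false = s≤s z≤n
  offset<width ω (inj₂ q) = s≤s (*-monoʳ-< 2 {toℕ q} {t} (Fin.toℕ<n q))

  lifted-sameOrder : ∀ ω → SameOrder (inputs ω ∘ inj₁) X
  lifted-sameOrder ω = strictlyMonotone⇒sameOrder X-injective
    (λ i j → lexicographic-< width (offset<width ω (inj₁ i)))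

  lifted-comparisons : ∀ (A : Mergesort m) ω → comparisons A (inputs ω ∘ inj₁) ≡ comparisons A X
  lifted-comparisons A ω = proj₂ (execute-sameOrder A (lifted-sameOrder ω))

  inputs-injective : ∀ ω → Injective _≡_ _≡_ (inputs ω)
  inputs-injective ω {k} {k′} eq =
    same-place k k′ (lexicographic-injective width {level k} {level k′} {offset ω k} {offset ω k′}
                       (offset<width ω k) (offset<width ω k′) eq)
    where
    same-place : ∀ k k′ → level k ≡ level k′ × offset ω k ≡ offset ω k′ → k ≡ k′
    same-place (inj₁ i) (inj₁ j) (same-level , _) = cong inj₁ (X-injective same-level)
    same-place (inj₁ i) (inj₂ q) (_ , even≡odd) = contradiction even≡odd (even≢odd (shift ω i) (toℕ q))
    same-place (inj₂ q) (inj₁ i) (_ , odd≡even) = contradiction (sym odd≡even) (even≢odd (shift ω i) (toℕ q))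
    same-place (inj₂ q) (inj₂ q′) (_ , same-offset) =
      cong inj₂ (Fin.toℕ-injective (*-cancelˡ-≡ (toℕ q) (toℕ q′) 2 (suc-injective same-offset)))

  sliding : SlidingInputs inputs (inj₁ p)
  sliding = record
    { injective  = inputs-injective
    ; sameOrder₁ = λ ω ω′ → sameOrder-trans {u = inputs ω ∘ inj₁} {X} {inputs ω′ ∘ inj₁}
                              (lifted-sameOrder ω)
                              (sameOrder-sym {v = inputs ω′ ∘ inj₁} {X} (lifted-sameOrder ω′))
    ; sameOrder₂ = λ _ _ _ _ → refl
    ; stable     = stable
    ; overtakes  = overtakes
    }
    where
    stable : ∀ ω ω′ k → k ≢ inj₁ p → inputs ω k ≡ inputs ω′ k
    stable ω ω′ (inj₁ i) i≢p = cong (λ s → width * X i + 2 * s)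
      (trans (shift-≢p ω (i≢p ∘ cong inj₁)) (sym (shift-≢p ω′ (i≢p ∘ cong inj₁))))
    stable ω ω′ (inj₂ q) _ = refl
    overtakes : ∀ {ω ω′} → ω <ᶠ ω′ → ∃ λ k → inputs ω (inj₁ p) < inputs ω k × inputs ω′ k < inputs ω′ (inj₁ p)
    overtakes {ω} {ω′} ω<ω′ = inj₂ q ,
      subst (λ s → width * X p + 2 * s < inputs ω (inj₂ q)) (sym (shift-p ω))
            (+-monoʳ-< (width * X p) just-below) ,
      subst (λ s → inputs ω′ (inj₂ q) < width * X p + 2 * s) (sym (shift-p ω′))
            (+-monoʳ-< (width * X p) just-above)
      where
      ω<t : toℕ ω < t
      ω<t = <-≤-trans ω<ω′ (≤-pred (Fin.toℕ<n ω′))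
      q : Fin t
      q = fromℕ< ω<t
      q≡ω : toℕ q ≡ toℕ ω
      q≡ω = Fin.toℕ-fromℕ< ω<t
      just-below : 2 * toℕ ω < suc (2 * toℕ q)
      just-below = s≤s (≤-reflexive (cong (2 *_) (sym q≡ω)))
      just-above : suc (2 * toℕ q) < 2 * toℕ ω′
      just-above = subst (_≤ 2 * toℕ ω′) (*-suc 2 (toℕ q)) (*-monoʳ-≤ 2 (subst (_< toℕ ω′) (sym q≡ω) ω<ω′))

-- The adversary

-- Kept apart from heavyPathBound so that heavyChild can rewrite the choice b ≤? a.
heavierChildBound : ∀ {a b} → Dec (b ≤ a) → ℕ → ℕ → ℕ
heavierChildBound {a} {b} (yes _) left right = left + ⌊log₂ suc (suc b) ⌋
heavierChildBound {a} {b} (no _)  left right = right + ⌊log₂ suc (suc a) ⌋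

heavyPathBound : ∀ {n} → Mergesort n → ℕ
heavyPathBound single = 0
heavyPathBound (split {a} {b} σ L R M _) = heavierChildBound (b ≤? a) (heavyPathBound L) (heavyPathBound R)

adversary : ∀ {n} (A : Mergesort n) →
  ∃ λ x → Injective _≡_ _≡_ x × ∃ λ p → heavyPathBound A ≤ fragility A x p
adversary single = (λ _ → 0) , (λ { {Fin.zero} {Fin.zero} _ → refl }) , Fin.zero , z≤n
adversary (split {a} {b} σ L R M correct) with b ≤? a
... | yes _ =
  let X , X-injective , p , bound = adversary L
      open SlidingConstruction X X-injective p (suc b)
  in  split-adversary sliding λ ω →
        ≤-trans bound (≤-reflexive (cong (participations p) (sym (lifted-comparisons L ω))))
  where open SideInput σ L R M correct
... | no _ =
  let Y , Y-injective , p , bound = adversary R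
      open SlidingConstruction Y Y-injective p (suc a)
  in  split-adversary (slidingInputs-swap sliding) λ ω →
        ≤-trans bound (≤-reflexive (cong (participations p) (sym (lifted-comparisons R ω))))
  where open SideInput σ L R M correct

2^k≤n⇒k≤⌊log₂n⌋ : ∀ {k n} → 2 ^ k ≤ n → k ≤ ⌊log₂ n ⌋
2^k≤n⇒k≤⌊log₂n⌋ {k} 2^k≤n = subst (_≤ _) (⌊log₂[2^n]⌋≡n k) (⌊log₂⌋-mono-≤ 2^k≤n)

n<2^[1+⌊log₂n⌋] : ∀ n → n < 2 ^ suc ⌊log₂ n ⌋
n<2^[1+⌊log₂n⌋] n = ≰⇒> (λ 2^[1+ℓ]≤n → n≮n _ (2^k≤n⇒k≤⌊log₂n⌋ 2^[1+ℓ]≤n))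

2*⌊n/2⌋≤n : ∀ n → 2 * ⌊ n /2⌋ ≤ n
2*⌊n/2⌋≤n n = begin
  2 * ⌊ n /2⌋          ≡⟨ cong (⌊ n /2⌋ +_) (+-identityʳ ⌊ n /2⌋) ⟩
  ⌊ n /2⌋ + ⌊ n /2⌋    ≤⟨ +-monoʳ-≤ ⌊ n /2⌋ (⌊n/2⌋≤⌈n/2⌉ n) ⟩
  ⌊ n /2⌋ + ⌈ n /2⌉    ≡⟨ ⌊n/2⌋+⌈n/2⌉≡n n ⟩
  n                    ∎
  where open ≤-Reasoning

⌊log₂n⌋≡1+⌊log₂⌊n/2⌋⌋ : ∀ {n} → 2 ≤ n → ⌊log₂ n ⌋ ≡ suc ⌊log₂ ⌊ n /2⌋ ⌋
⌊log₂n⌋≡1+⌊log₂⌊n/2⌋⌋ {n} 2≤n = begin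
  ⌊log₂ n ⌋                ≡⟨ m∸n+n≡m (2^k≤n⇒k≤⌊log₂n⌋ {1} 2≤n) ⟨
  ⌊log₂ n ⌋ ∸ 1 + 1        ≡⟨ +-comm _ 1 ⟩
  suc (⌊log₂ n ⌋ ∸ 1)      ≡⟨ cong suc (⌊log₂⌊n/2⌋⌋≡⌊log₂n⌋∸1 n) ⟨
  suc ⌊log₂ ⌊ n /2⌋ ⌋      ∎
  where open ≡-Reasoning

2^⌊log₂n⌋≤n : ∀ {n} → 0 < n → 2 ^ ⌊log₂ n ⌋ ≤ n
2^⌊log₂n⌋≤n {n} = <-rec (λ n → 0 < n → 2 ^ ⌊log₂ n ⌋ ≤ n) step n
  where
  step : ∀ n → (∀ {m} → m < n → 0 < m → 2 ^ ⌊log₂ m ⌋ ≤ m) → 0 < n → 2 ^ ⌊log₂ n ⌋ ≤ n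
  step 1 _ _ = ≤-refl
  step n@(suc (suc k)) rec _ = begin
    2 ^ ⌊log₂ n ⌋              ≡⟨ cong (2 ^_) (⌊log₂n⌋≡1+⌊log₂⌊n/2⌋⌋ {n} (s≤s (s≤s z≤n))) ⟩
    2 * 2 ^ ⌊log₂ ⌊ n /2⌋ ⌋    ≤⟨ *-monoʳ-≤ 2 (rec {⌊ n /2⌋} (⌊n/2⌋<n (suc k)) (s≤s z≤n)) ⟩
    2 * ⌊ n /2⌋                ≤⟨ 2*⌊n/2⌋≤n n ⟩
    n                          ∎
    where open ≤-Reasoning

n<2^k⇒⌊log₂n⌋<k : ∀ {n k} → 0 < n → n < 2 ^ k → ⌊log₂ n ⌋ < k
n<2^k⇒⌊log₂n⌋<k {n} {k} 0<n n<2^k =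
  ≰⇒> (λ k≤ℓ → <-irrefl refl (<-≤-trans n<2^k (≤-trans (^-monoʳ-≤ 2 k≤ℓ) (2^⌊log₂n⌋≤n 0<n))))

+≤*+1 : ∀ {m n} → 0 < m → 0 < n → m + n ≤ m * n + 1
+≤*+1 {suc m} {suc n} _ _ = subst (suc m + suc n ≤_) (sym (expand m n)) (m≤m+n (suc m + suc n) (m * n))
  where
  expand : ∀ m n → suc m * suc n + 1 ≡ suc m + suc n + m * n
  expand = solve-∀

⌊log₂1+⌋-subadditive : ∀ x y → ⌊log₂ suc (x + y) ⌋ ≤ ⌊log₂ suc x ⌋ + ⌊log₂ suc y ⌋
⌊log₂1+⌋-subadditive x y = ≤-pred (n<2^k⇒⌊log₂n⌋<k (s≤s z≤n) (+-cancelʳ-≤ 2 _ _ (begin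
  suc (suc (x + y)) + 2   ≡⟨ regroup x y ⟩
  (2 + x) + (2 + y)       ≤⟨ +-mono-≤ (n<2^[1+⌊log₂n⌋] (suc x)) (n<2^[1+⌊log₂n⌋] (suc y)) ⟩
  2 * A + 2 * B           ≡⟨ *-distribˡ-+ 2 A B ⟨
  2 * (A + B)             ≤⟨ *-monoʳ-≤ 2 (+≤*+1 (m^n>0 2 p) (m^n>0 2 q)) ⟩
  2 * (A * B + 1)         ≡⟨ *-distribˡ-+ 2 (A * B) 1 ⟩
  2 * (A * B) + 2         ≡⟨ cong (λ z → 2 * z + 2) (^-distribˡ-+-* 2 p q) ⟨
  2 ^ suc (p + q) + 2     ∎)))
  where
  open ≤-Reasoning
  p q A B : ℕ
  p = ⌊log₂ suc x ⌋
  q = ⌊log₂ suc y ⌋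
  A = 2 ^ p
  B = 2 ^ q
  regroup : ∀ x y → suc (suc (x + y)) + 2 ≡ (2 + x) + (2 + y)
  regroup = solve-∀

-- Summing along the heavy path

record HeavyChild {n} (A : Mergesort n) : Set where
  field
    size lightSize : ℕ
    heavy          : Mergesort size
    sizes          : size + lightSize ≡ n
    light≤size     : lightSize ≤ size
    0<light        : 0 < lightSize
    bound          : heavyPathBound A ≡ heavyPathBound heavy + ⌊log₂ suc lightSize ⌋

heavyChild : ∀ {a b} σ L R M correct → HeavyChild (split {a} {b} σ L R M correct)
heavyChild {a} {b} σ L R M correct with b ≤? a in choice
... | yes b≤a = record
  { heavy = L ; sizes = refl ; light≤size = s≤s b≤a ; 0<light = s≤s z≤n
  ; bound = cong (λ d → heavierChildBound d (heavyPathBound L) (heavyPathBound R)) choice }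
... | no b≰a = record
  { heavy = R ; sizes = +-comm (suc b) (suc a) ; 0<light = s≤s z≤n
  ; light≤size = ≤-trans (n≤1+n (suc a)) (s≤s (≰⇒> b≰a))
  ; bound = cong (λ d → heavierChildBound d (heavyPathBound L) (heavyPathBound R)) choice }

record Cut (h : ℕ) {n} (A : Mergesort n) : Set where
  field
    size rest : ℕ
    subtree   : Mergesort size
    sizes     : size + rest ≡ n
    size≤h    : size ≤ h
    h<2*size  : h < 2 * size
    bound     : ⌊log₂ suc rest ⌋ + heavyPathBound subtree ≤ heavyPathBound A

cut-through : ∀ {h n} {A : Mergesort n} → HeavyChild A → h < n →
  (∀ {m} → m < n → (B : Mergesort m) → h < m → Cut h B) → Cut h A
cut-through {h} {n} {A} H h<n rec with HeavyChild.size H ≤? h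
... | yes size≤h = record
  { subtree = heavy ; sizes = sizes ; size≤h = size≤h
  ; h<2*size = <-≤-trans h<n (begin
      n                 ≡⟨ sizes ⟨
      size + lightSize  ≤⟨ +-monoʳ-≤ size light≤size ⟩
      size + size       ≡⟨ cong (size +_) (+-identityʳ size) ⟨
      2 * size          ∎)
  ; bound = ≤-reflexive (trans (+-comm _ (heavyPathBound heavy)) (sym bound)) }
  where open HeavyChild H
        open ≤-Reasoning
... | no size≰h = record
  { subtree = Cut.subtree inner
  ; sizes = trans (sym (+-assoc (Cut.size inner) (Cut.rest inner) lightSize))
                  (trans (cong (_+ lightSize) (Cut.sizes inner)) sizes)
  ; size≤h = Cut.size≤h inner ; h<2*size = Cut.h<2*size inner
  ; bound = begin
      ⌊log₂ suc (Cut.rest inner + lightSize) ⌋ + heavyPathBound (Cut.subtree inner)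
        ≤⟨ +-monoˡ-≤ _ (⌊log₂1+⌋-subadditive (Cut.rest inner) lightSize) ⟩
      ⌊log₂ suc (Cut.rest inner) ⌋ + ⌊log₂ suc lightSize ⌋ + heavyPathBound (Cut.subtree inner)
        ≡⟨ xy∙z≈xz∙y _ ⌊log₂ suc lightSize ⌋ (heavyPathBound (Cut.subtree inner)) ⟩
      ⌊log₂ suc (Cut.rest inner) ⌋ + heavyPathBound (Cut.subtree inner) + ⌊log₂ suc lightSize ⌋
        ≤⟨ +-monoˡ-≤ _ (Cut.bound inner) ⟩
      heavyPathBound heavy + ⌊log₂ suc lightSize ⌋
        ≡⟨ bound ⟨
      heavyPathBound A ∎ }
  where open HeavyChild H
        open ≤-Reasoning
        inner : Cut h heavy
        inner = rec (subst (size <_) sizes (m<m+n size 0<light)) heavy (≰⇒> size≰h)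

cut : ∀ {h} → 0 < h → ∀ {n} (A : Mergesort n) → h < n → Cut h A
cut {h} 0<h {n} = <-rec (λ n → (A : Mergesort n) → h < n → Cut h A) step n
  where
  step : ∀ n → (∀ {m} → m < n → (A : Mergesort m) → h < m → Cut h A) →
         (A : Mergesort n) → h < n → Cut h A
  step _ _ single h<1 = contradiction (<-≤-trans 0<h (≤-pred h<1)) (<-irrefl refl)
  step n rec (split σ L R M correct) h<n = cut-through (heavyChild σ L R M correct) h<n rec

-- quarterSquare m = ⌈m² / 4⌉
quarterSquare : ℕ → ℕ
quarterSquare 0 = 0
quarterSquare 1 = 1
quarterSquare (suc (suc m)) = quarterSquare m + suc m

quarterSquare-≤-suc : ∀ m → quarterSquare m ≤ quarterSquare (suc m)
quarterSquare-≤-suc 0 = z≤n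
quarterSquare-≤-suc 1 = s≤s z≤n
quarterSquare-≤-suc (suc (suc m)) = +-mono-≤ (quarterSquare-≤-suc m) (n≤1+n (suc m))

quarterSquare-mono : ∀ {m m′} → m ≤ m′ → quarterSquare m ≤ quarterSquare m′
quarterSquare-mono = mono′ ∘ ≤⇒≤′
  where
  mono′ : ∀ {m m′} → m ≤′ m′ → quarterSquare m ≤ quarterSquare m′
  mono′ ≤′-refl = ≤-refl
  mono′ (≤′-step {m′} m≤′m′) = ≤-trans (mono′ m≤′m′) (quarterSquare-≤-suc m′)

m*m≤4*quarterSquare : ∀ m → m * m ≤ 4 * quarterSquare m
m*m≤4*quarterSquare 0 = z≤n
m*m≤4*quarterSquare 1 = s≤s z≤n
m*m≤4*quarterSquare (suc (suc m)) = begin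
  suc (suc m) * suc (suc m)            ≡⟨ expand m ⟩
  m * m + 4 * suc m                    ≤⟨ +-monoˡ-≤ (4 * suc m) (m*m≤4*quarterSquare m) ⟩
  4 * quarterSquare m + 4 * suc m      ≡⟨ *-distribˡ-+ 4 (quarterSquare m) (suc m) ⟨
  4 * (quarterSquare m + suc m)        ∎
  where
  open ≤-Reasoning
  expand : ∀ m → suc (suc m) * suc (suc m) ≡ m * m + 4 * suc m
  expand = solve-∀

quarterSquare-suc-≤ : ∀ {k r s} → k ≤ r → 1 ≤ r → k ≤ suc s →
                      quarterSquare (suc k) ≤ r + quarterSquare s
quarterSquare-suc-≤ {zero} _ 1≤r _ = ≤-trans 1≤r (m≤m+n _ _)
quarterSquare-suc-≤ {suc m} {r} {s} m<r _ m<1+s = begin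
  quarterSquare m + suc m      ≡⟨ +-comm (quarterSquare m) (suc m) ⟩
  suc m + quarterSquare m      ≤⟨ +-mono-≤ m<r (quarterSquare-mono (≤-pred m<1+s)) ⟩
  r + quarterSquare s          ∎
  where open ≤-Reasoning

rest-of-half-cut : ∀ {n} {A : Mergesort n} (C : Cut ⌊ n /2⌋ A) → ⌊ n /2⌋ ≤ Cut.rest C
rest-of-half-cut {n} C = +-cancelˡ-≤ h h rest (begin
  h + h        ≡⟨ cong (h +_) (+-identityʳ h) ⟨
  2 * h        ≤⟨ 2*⌊n/2⌋≤n n ⟩
  n            ≡⟨ sizes ⟨
  size + rest  ≤⟨ +-monoˡ-≤ rest size≤h ⟩
  h + rest     ∎)
  where
  open Cut C
  open ≤-Reasoning
  h : ℕ
  h = ⌊ n /2⌋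

quarterSquare-≤-heavyPathBound : ∀ {n} (A : Mergesort n) → quarterSquare ⌊log₂ n ⌋ ≤ heavyPathBound A
quarterSquare-≤-heavyPathBound {n} =
  <-rec (λ n → (A : Mergesort n) → quarterSquare ⌊log₂ n ⌋ ≤ heavyPathBound A) step n
  where
  step : ∀ n → (∀ {m} → m < n → (A : Mergesort m) → quarterSquare ⌊log₂ m ⌋ ≤ heavyPathBound A) →
         (A : Mergesort n) → quarterSquare ⌊log₂ n ⌋ ≤ heavyPathBound A
  step 0 _ _ = z≤n
  step 1 _ _ = z≤n
  step n@(suc (suc n′)) rec A = begin
    quarterSquare ⌊log₂ n ⌋
      ≡⟨ cong quarterSquare (⌊log₂n⌋≡1+⌊log₂⌊n/2⌋⌋ {n} (s≤s (s≤s z≤n))) ⟩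
    quarterSquare (suc ⌊log₂ h ⌋)                  ≤⟨ quarterSquare-suc-≤ ℓh≤ℓ[1+rest] 1≤ℓ[1+rest] ℓh≤1+ℓsize ⟩
    ⌊log₂ suc rest ⌋ + quarterSquare ⌊log₂ size ⌋  ≤⟨ +-monoʳ-≤ _ (rec (≤-<-trans size≤h h<n) subtree) ⟩
    ⌊log₂ suc rest ⌋ + heavyPathBound subtree      ≤⟨ bound ⟩
    heavyPathBound A                               ∎
    where
    open ≤-Reasoning
    h : ℕ
    h = ⌊ n /2⌋
    h<n : h < n
    h<n = ⌊n/2⌋<n (suc n′)
    open Cut (cut (s≤s z≤n) A h<n)
    h≤rest : h ≤ rest
    h≤rest = rest-of-half-cut (cut (s≤s z≤n) A h<n)
    1≤ℓ[1+rest] : 1 ≤ ⌊log₂ suc rest ⌋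
    1≤ℓ[1+rest] = 2^k≤n⇒k≤⌊log₂n⌋ {1} (s≤s (≤-trans (s≤s z≤n) h≤rest))
    ℓh≤ℓ[1+rest] : ⌊log₂ h ⌋ ≤ ⌊log₂ suc rest ⌋
    ℓh≤ℓ[1+rest] = ⌊log₂⌋-mono-≤ (m≤n⇒m≤1+n h≤rest)
    ℓh≤1+ℓsize : ⌊log₂ h ⌋ ≤ suc ⌊log₂ size ⌋
    ℓh≤1+ℓsize = ⌊log₂⌋-≤-suc (*-cancelˡ-< 2 0 size (≤-<-trans z≤n h<2*size)) (<⇒≤ h<2*size)

theorem31 : ∃ λ (k : ℕ) → ∀ (n : ℕ) (A : Mergesort n) →
              ∃ λ (x : Fin n → ℕ) → Injective _≡_ _≡_ x ×
                ∃ λ (p : Fin n) → ⌊log₂ n ⌋ * ⌊log₂ n ⌋ ≤ k * fragility A x p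
theorem31 = 4 , λ n A →
  let x , x-injective , p , bound = adversary A
  in  x , x-injective , p , (begin
        ⌊log₂ n ⌋ * ⌊log₂ n ⌋            ≤⟨ m*m≤4*quarterSquare ⌊log₂ n ⌋ ⟩
        4 * quarterSquare ⌊log₂ n ⌋      ≤⟨ *-monoʳ-≤ 4 (quarterSquare-≤-heavyPathBound A) ⟩
        4 * heavyPathBound A             ≤⟨ *-monoʳ-≤ 4 bound ⟩
        4 * fragility A x p              ∎)
  where open ≤-Reasoning
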